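{- Let $A$ be a dendriform algebra over a field $k$, augmented by a unit $1$ as described in the context, and let $a\in A$. Then for every integer $n\ge 1$, $$\sum_{p=0}^{n-1} (-1)^p\,(n-p)\; w^{(p)}_{\prec}(a) * w^{(n-p)}_{\succ}(a) \;=\; \ell^{(n)}(a),$$ i.e. $D\big(w^{(n)}_{\succ}(a)\big)=\ell^{(n)}(a)$, where $D=S\star N$ is the Dynkin operator described in the context.
   Context: A dendriform algebra over $k$ is a $k$-vector space $A$ with bilinear operations $\prec,\succ$ satisfying $(a\prec b)\prec c=a\prec(b*c)$, $(a\succ b)\prec c=a\succ(b\prec c)$, $a\succ(b\succ c)=(a*b)\succ c$, where $a*b:=a\prec b+a\succ b$ (an associative product). Adjoin a unit $1$ with the conventions $a\prec 1:=a$, $1\succ a:=a$, $1\prec a:=0$, $a\succ 1:=0$ for $a\in A$ (so $a*1=1*a=a$). For fixed $x\in A$ set $w^{(0)}_\prec(x)=w^{(0)}_\succ(x)=1$, $w^{(n)}_\prec(x):=x\prec w^{(n-1)}_\prec(x)$, $w^{(n)}_\succ(x):=w^{(n-1)}_\succ(x)\succ x$. Define $a\rhd b:=a\succ b-b\prec a$, and $\ell^{(1)}(a):=a$, $\ell^{(n+1)}(a):=\ell^{(n)}(a)\rhd a$. The elements $w^{(n)}_\succ(a)$ span (under $*$) a graded connected cocommutative Hopf algebra $H$ with coproduct $\Delta(w^{(n)}_\succ)=\sum_{m=0}^n w^{(m)}_\succ\otimes w^{(n-m)}_\succ$ and antipode $S(w^{(n)}_\succ)=(-1)^n w^{(n)}_\prec$;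 $N$ is the grading operator ($N(w^{(n)}_\succ)=n\,w^{(n)}_\succ$), $\star$ is the convolution product, and the Dynkin operator is $D:=S\star N$. Unpacking, $D(w^{(n)}_\succ(a))$ is exactly the left-hand side of the claimed identity. -}

module Defs where

open import Level using (Level; _⊔_)
open import Data.Nat using (ℕ; zero; suc; _∸_)
open import Data.Product using (_×_; _,_; proj₁; proj₂; ∃)
open import Relation.Nullary using (¬_)
open import Algebra.Bundles using (CommutativeRing)
open import Algebra.Module.Bundles using (Module)

record IsField {c ℓ : Level} (K : CommutativeRing c ℓ) : Set (c ⊔ ℓ) where
  open CommutativeRing K
  field
    1≉0     : ¬ (1# ≈ 0#)
    inverse : ∀ x → ¬ (x ≈ 0#) → ∃ λ y → x * y ≈ 1#

record Dendriform {c ℓ m ℓm : Level} {K : CommutativeRing c ℓ}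
                  (M : Module K m ℓm) : Set (c ⊔ m ⊔ ℓm) where
  open CommutativeRing K using () renaming (Carrier to k)
  open Module M
  infixl 7 _≺_ _≻_ _⋆_
  field
    _≺_ : Carrierᴹ → Carrierᴹ → Carrierᴹ
    _≻_ : Carrierᴹ → Carrierᴹ → Carrierᴹ
  _⋆_ : Carrierᴹ → Carrierᴹ → Carrierᴹ
  a ⋆ b = (a ≺ b) +ᴹ (a ≻ b)
  field
    ≺-cong  : ∀ {a a' b b'} → a ≈ᴹ a' → b ≈ᴹ b' → (a ≺ b) ≈ᴹ (a' ≺ b')
    ≻-cong  : ∀ {a a' b b'} → a ≈ᴹ a' → b ≈ᴹ b' → (a ≻ b) ≈ᴹ (a' ≻ b')
    ≺-distribʳ : ∀ a b c → ((a +ᴹ b) ≺ c) ≈ᴹ ((a ≺ c) +ᴹ (b ≺ c))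
    ≺-distribˡ : ∀ a b c → (a ≺ (b +ᴹ c)) ≈ᴹ ((a ≺ b) +ᴹ (a ≺ c))
    ≻-distribʳ : ∀ a b c → ((a +ᴹ b) ≻ c) ≈ᴹ ((a ≻ c) +ᴹ (b ≻ c))
    ≻-distribˡ : ∀ a b c → (a ≻ (b +ᴹ c)) ≈ᴹ ((a ≻ b) +ᴹ (a ≻ c))
    ≺-scalarˡ  : ∀ (λ' : k) a b → ((λ' *ₗ a) ≺ b) ≈ᴹ (λ' *ₗ (a ≺ b))
    ≺-scalarʳ  : ∀ (λ' : k) a b → (a ≺ (λ' *ₗ b)) ≈ᴹ (λ' *ₗ (a ≺ b))
    ≻-scalarˡ  : ∀ (λ' : k) a b → ((λ' *ₗ a) ≻ b) ≈ᴹ (λ' *ₗ (a ≻ b))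
    ≻-scalarʳ  : ∀ (λ' : k) a b → (a ≻ (λ' *ₗ b)) ≈ᴹ (λ' *ₗ (a ≻ b))
    axiom₁ : ∀ a b c → ((a ≺ b) ≺ c) ≈ᴹ (a ≺ (b ⋆ c))
    axiom₂ : ∀ a b c → ((a ≻ b) ≺ c) ≈ᴹ (a ≻ (b ≺ c))
    axiom₃ : ∀ a b c → (a ≻ (b ≻ c)) ≈ᴹ ((a ⋆ b) ≻ c)

-- The unital augmentation  Ā = k·1 ⊕ A,  elements written (λ , a) = λ·1 + a,
-- together with the operations of the statement.
module Augmented {c ℓ m ℓm : Level} {K : CommutativeRing c ℓ}
                 {M : Module K m ℓm} (D : Dendriform M) where
  open CommutativeRing K renaming (Carrier to k)
  open Module M
  open Dendriform D

  Ā : Set (c ⊔ m)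
  Ā = k × Carrierᴹ

  _≈̄_ : Ā → Ā → Set (ℓ ⊔ ℓm)
  (λ₁ , a) ≈̄ (λ₂ , b) = (λ₁ ≈ λ₂) × (a ≈ᴹ b)

  ι : Carrierᴹ → Ā
  ι a = (0# , a)

  𝟙 : Ā
  𝟙 = (1# , 0ᴹ)

  _+̄_ : Ā → Ā → Ā
  (λ₁ , a) +̄ (λ₂ , b) = (λ₁ + λ₂ , a +ᴹ b)

  _·̄_ : k → Ā → Ā
  μ ·̄ (λ' , a) = (μ * λ' , μ *ₗ a)

  -- the associative product extended by 1 * x = x * 1 = x (and 1 * 1 = 1):
  -- (λ·1 + a) * (μ·1 + b) = λμ·1 + (λ b + μ a + a * b)
  _⋆̄_ : Ā → Ā → Ā
  (λ₁ , a) ⋆̄ (λ₂ , b) = (λ₁ * λ₂ , ((λ₁ *ₗ b) +ᴹ (λ₂ *ₗ a)) +ᴹ (a ⋆ b))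

  -- x ≺ (λ·1 + b) := λ x + x ≺ b   (using x ≺ 1 = x),  x ∈ A
  _≺̄_ : Carrierᴹ → Ā → Carrierᴹ
  x ≺̄ (λ' , b) = (λ' *ₗ x) +ᴹ (x ≺ b)

  -- (λ·1 + b) ≻ x := λ x + b ≻ x   (using 1 ≻ x = x),  x ∈ A
  _≻̄_ : Ā → Carrierᴹ → Carrierᴹ
  (λ' , b) ≻̄ x = (λ' *ₗ x) +ᴹ (b ≻ x)

  w≺ : ℕ → Carrierᴹ → Ā
  w≺ zero    x = 𝟙
  w≺ (suc n) x = ι (x ≺̄ w≺ n x)

  w≻ : ℕ → Carrierᴹ → Ā
  w≻ zero    x = 𝟙
  w≻ (suc n) x = ι (w≻ n x ≻̄ x)

  _▷_ : Carrierᴹ → Carrierᴹ → Carrierᴹ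
  a ▷ b = (a ≻ b) +ᴹ (-ᴹ (b ≺ a))

  -- ℓ^{(n+1)}(a), i.e.  ℓ′ n a = ℓ^{(n+1)}(a)
  ℓ′ : ℕ → Carrierᴹ → Carrierᴹ
  ℓ′ zero    a = a
  ℓ′ (suc n) a = ℓ′ n a ▷ a

  nat : ℕ → k
  nat zero    = 0#
  nat (suc n) = 1# + nat n

  sgn : ℕ → k
  sgn zero    = 1#
  sgn (suc p) = - sgn p

  Σ̄ : ℕ → (ℕ → Ā) → Ā
  Σ̄ zero    f = (0# , 0ᴹ)
  Σ̄ (suc j) f = Σ̄ j f +̄ f j

  dynkinLHS : ℕ → Carrierᴹ → Ā
  dynkinLHS n a = Σ̄ n (λ p → (sgn p * nat (n ∸ p)) ·̄ (w≺ p a ⋆̄ w≻ (n ∸ p) a))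

-- Write M(p,q) for the A-component of w≺⁽ᵖ⁾(a) * w≻⁽q⁾(a). Splitting * = ≺ + ≻ and using the
-- first and third dendriform axioms (extended to the unit) peels an a off the left of
-- w≺⁽ᵖ⁺¹⁾ or off the right of w≻⁽q⁺¹⁾, so a weighted antidiagonal sum obeys
--   Σ_{p+q=n+1} c(p,q) M(p,q) = (Σ_{p+q=n} c(p,q+1) M(p,q)) ≻ a + a ≺ (Σ_{p+q=n} c(p+1,q) M(p,q)),
-- up to a multiple of a that only survives for n = 0.  With c = (-1)ᵖ this shows that
-- (S ⋆ id)(w≻⁽ⁿ⁾) has no component in A; with c = (-1)ᵖ q it then gives
-- D(w≻⁽¹⁾) = a and D(w≻⁽ⁿ⁺²⁾) = D(w≻⁽ⁿ⁺¹⁾) ▷ a.  No inverses in k are needed.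
module Submission where

open import Defs
open import Level using (Level)
open import Data.Nat using (ℕ; zero; suc; _∸_; _<_; s≤s⁻¹)
open import Data.Nat.Properties using (+-∸-assoc; n∸n≡0; n<1+n; m<n⇒m<1+n)
open import Data.Product using (_,_; proj₁; proj₂)
open import Relation.Binary.PropositionalEquality using (cong)
open import Algebra.Bundles using (CommutativeRing; CommutativeMonoid)
open import Algebra.Module.Bundles using (Module)
import Algebra.Solver.CommutativeMonoid as CommutativeMonoidSolver
import Algebra.Properties.AbelianGroup as AbelianGroupProperties
import Algebra.Properties.Ring as RingProperties
import Algebra.Module.Properties as ModuleProperties
import Relation.Binary.Reasoning.Setoid as SetoidReasoning

module AntidiagonalSum {c ℓ : Level} (M : CommutativeMonoid c ℓ) where
  open CommutativeMonoid M
  open CommutativeMonoidSolver M using (solve; _⊕_; _⊜_)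
  open SetoidReasoning setoid

  ∑-antidiagonal : ℕ → (ℕ → ℕ → Carrier) → Carrier
  ∑-antidiagonal zero    f = f 0 0
  ∑-antidiagonal (suc n) f = f 0 (suc n) ∙ ∑-antidiagonal n (λ p q → f (suc p) q)

  ∑-antidiagonal-cong : ∀ n {f g : ℕ → ℕ → Carrier} → (∀ p q → f p q ≈ g p q) →
                        ∑-antidiagonal n f ≈ ∑-antidiagonal n g
  ∑-antidiagonal-cong zero    f≈g = f≈g 0 0
  ∑-antidiagonal-cong (suc n) f≈g =
    ∙-cong (f≈g 0 (suc n)) (∑-antidiagonal-cong n (λ p q → f≈g (suc p) q))

  ∑-antidiagonal-distrib : ∀ n (f g : ℕ → ℕ → Carrier) →
    ∑-antidiagonal n (λ p q → f p q ∙ g p q) ≈ ∑-antidiagonal n f ∙ ∑-antidiagonal n g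
  ∑-antidiagonal-distrib zero    f g = refl
  ∑-antidiagonal-distrib (suc n) f g = begin
    (f 0 (suc n) ∙ g 0 (suc n)) ∙ ∑-antidiagonal n (λ p q → f (suc p) q ∙ g (suc p) q)
      ≈⟨ ∙-congˡ (∑-antidiagonal-distrib n (λ p q → f (suc p) q) (λ p q → g (suc p) q)) ⟩
    (f 0 (suc n) ∙ g 0 (suc n)) ∙ (∑-antidiagonal n (λ p q → f (suc p) q) ∙
                                   ∑-antidiagonal n (λ p q → g (suc p) q))
      ≈⟨ solve 4 (λ a b c d → (a ⊕ b) ⊕ (c ⊕ d) ⊜ (a ⊕ c) ⊕ (b ⊕ d)) refl _ _ _ _ ⟩
    ∑-antidiagonal (suc n) f ∙ ∑-antidiagonal (suc n) g ∎

  ∑-antidiagonal-homo : (h : Carrier → Carrier) → (∀ {x y} → x ≈ y → h x ≈ h y) →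
                        (∀ x y → h (x ∙ y) ≈ h x ∙ h y) →
                        ∀ n f → ∑-antidiagonal n (λ p q → h (f p q)) ≈ h (∑-antidiagonal n f)
  ∑-antidiagonal-homo h h-cong h-∙ zero    f = refl
  ∑-antidiagonal-homo h h-cong h-∙ (suc n) f =
    trans (∙-congˡ (∑-antidiagonal-homo h h-cong h-∙ n (λ p q → f (suc p) q))) (sym (h-∙ _ _))

  ∑-antidiagonal-unsnoc : ∀ n f →
    ∑-antidiagonal (suc n) f ≈ ∑-antidiagonal n (λ p q → f p (suc q)) ∙ f (suc n) 0
  ∑-antidiagonal-unsnoc zero    f = refl
  ∑-antidiagonal-unsnoc (suc n) f =
    trans (∙-congˡ (∑-antidiagonal-unsnoc n (λ p q → f (suc p) q))) (sym (assoc _ _ _))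

  ∑-antidiagonal-≈ε : ∀ n f → (∀ p q → f p q ≈ ε) → ∑-antidiagonal n f ≈ ε
  ∑-antidiagonal-≈ε zero    f f≈ε = f≈ε 0 0
  ∑-antidiagonal-≈ε (suc n) f f≈ε =
    trans (∙-cong (f≈ε 0 (suc n)) (∑-antidiagonal-≈ε n _ (λ p q → f≈ε (suc p) q))) (identityˡ ε)

module DendriformProperties {c ℓ m ℓm : Level} {K : CommutativeRing c ℓ} {M : Module K m ℓm}
                            (D : Dendriform M) where
  open CommutativeRing K renaming (Carrier to k)
  open RingProperties ring using (-‿distribˡ-*)
  open Module M
  open ModuleProperties M using (x≈0⇒x*y≈0; y≈0⇒x*y≈0; inverseʳ-uniqueᴹ)
  open AbelianGroupProperties +ᴹ-abelianGroup using (ε⁻¹≈ε; ⁻¹-∙-comm)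
  open CommutativeMonoidSolver +ᴹ-commutativeMonoid using (solve; _⊕_; _⊜_)
  open AntidiagonalSum +ᴹ-commutativeMonoid
  open Dendriform D
  open Augmented D
  open SetoidReasoning ≈ᴹ-setoid

  ≺-zeroˡ : ∀ x → 0ᴹ ≺ x ≈ᴹ 0ᴹ
  ≺-zeroˡ x = ≈ᴹ-trans (≺-cong (≈ᴹ-sym (*ₗ-zeroˡ 0ᴹ)) ≈ᴹ-refl) (≈ᴹ-trans (≺-scalarˡ 0# 0ᴹ x) (*ₗ-zeroˡ _))

  ≺-zeroʳ : ∀ x → x ≺ 0ᴹ ≈ᴹ 0ᴹ
  ≺-zeroʳ x = ≈ᴹ-trans (≺-cong ≈ᴹ-refl (≈ᴹ-sym (*ₗ-zeroˡ 0ᴹ))) (≈ᴹ-trans (≺-scalarʳ 0# x 0ᴹ) (*ₗ-zeroˡ _))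

  ≻-zeroˡ : ∀ x → 0ᴹ ≻ x ≈ᴹ 0ᴹ
  ≻-zeroˡ x = ≈ᴹ-trans (≻-cong (≈ᴹ-sym (*ₗ-zeroˡ 0ᴹ)) ≈ᴹ-refl) (≈ᴹ-trans (≻-scalarˡ 0# 0ᴹ x) (*ₗ-zeroˡ _))

  ≻-zeroʳ : ∀ x → x ≻ 0ᴹ ≈ᴹ 0ᴹ
  ≻-zeroʳ x = ≈ᴹ-trans (≻-cong ≈ᴹ-refl (≈ᴹ-sym (*ₗ-zeroˡ 0ᴹ))) (≈ᴹ-trans (≻-scalarʳ 0# x 0ᴹ) (*ₗ-zeroˡ _))

  ≺-negʳ : ∀ x y → x ≺ (-ᴹ y) ≈ᴹ -ᴹ (x ≺ y)
  ≺-negʳ x y = inverseʳ-uniqueᴹ (x ≺ y) (x ≺ (-ᴹ y)) (begin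
    x ≺ y +ᴹ x ≺ (-ᴹ y)  ≈⟨ ≺-distribˡ x y (-ᴹ y) ⟨
    x ≺ (y +ᴹ -ᴹ y)      ≈⟨ ≺-cong ≈ᴹ-refl (-ᴹ‿inverseʳ y) ⟩
    x ≺ 0ᴹ               ≈⟨ ≺-zeroʳ x ⟩
    0ᴹ                   ∎)

  -‿*ₗ : ∀ α x → (- α) *ₗ x ≈ᴹ -ᴹ (α *ₗ x)
  -‿*ₗ α x = inverseʳ-uniqueᴹ (α *ₗ x) ((- α) *ₗ x) (begin
    α *ₗ x +ᴹ (- α) *ₗ x  ≈⟨ *ₗ-distribʳ x α (- α) ⟨
    (α + - α) *ₗ x        ≈⟨ x≈0⇒x*y≈0 (-‿inverseʳ α) ⟩
    0ᴹ                    ∎)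

  ⋆-zero : 0ᴹ ⋆ 0ᴹ ≈ᴹ 0ᴹ
  ⋆-zero = ≈ᴹ-trans (+ᴹ-cong (≺-zeroˡ 0ᴹ) (≻-zeroˡ 0ᴹ)) (+ᴹ-identityˡ 0ᴹ)

  ▷-congˡ : ∀ {x y} z → x ≈ᴹ y → x ▷ z ≈ᴹ y ▷ z
  ▷-congˡ z x≈y = +ᴹ-cong (≻-cong x≈y ≈ᴹ-refl) (-ᴹ‿cong (≺-cong ≈ᴹ-refl x≈y))

  ▷-zeroˡ : ∀ z → 0ᴹ ▷ z ≈ᴹ 0ᴹ
  ▷-zeroˡ z = ≈ᴹ-trans (+ᴹ-cong (≻-zeroˡ z) (≈ᴹ-trans (-ᴹ‿cong (≺-zeroʳ z)) ε⁻¹≈ε)) (+ᴹ-identityˡ 0ᴹ)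

  -- The A-components of (λ·1 + x) ≺ (μ·1 + y) and (λ·1 + x) ≻ (μ·1 + y) under the unit
  -- conventions; 1 ≺ 1 and 1 ≻ 1 get no A-component.
  _≺̂_ : Ā → Ā → Carrierᴹ
  (_ , x) ≺̂ (μ , y) = μ *ₗ x +ᴹ x ≺ y

  _≻̂_ : Ā → Ā → Carrierᴹ
  (λ' , x) ≻̂ (_ , y) = λ' *ₗ y +ᴹ x ≻ y

  ⋆̄-split : ∀ X Y → proj₂ (X ⋆̄ Y) ≈ᴹ X ≺̂ Y +ᴹ X ≻̂ Y
  ⋆̄-split (λ' , x) (μ , y) =
    solve 4 (λ a b c d → (a ⊕ b) ⊕ (c ⊕ d) ⊜ (b ⊕ c) ⊕ (a ⊕ d)) ≈ᴹ-refl _ _ _ _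

  𝟙-≺̂ : ∀ Y → 𝟙 ≺̂ Y ≈ᴹ 0ᴹ
  𝟙-≺̂ (μ , y) = ≈ᴹ-trans (+ᴹ-cong (*ₗ-zeroʳ μ) (≺-zeroˡ y)) (+ᴹ-identityˡ 0ᴹ)

  ≻̂-𝟙 : ∀ X → X ≻̂ 𝟙 ≈ᴹ 0ᴹ
  ≻̂-𝟙 (λ' , x) = ≈ᴹ-trans (+ᴹ-cong (*ₗ-zeroʳ λ') (≻-zeroʳ x)) (+ᴹ-identityˡ 0ᴹ)

  ≺̄-assoc : ∀ z X Y → ι (z ≺̄ X) ≺̂ Y ≈ᴹ z ≺̄ (X ⋆̄ Y)
  ≺̄-assoc z (λ' , x) (μ , y) = begin
    μ *ₗ (λ' *ₗ z +ᴹ z ≺ x) +ᴹ (λ' *ₗ z +ᴹ z ≺ x) ≺ y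
      ≈⟨ +ᴹ-cong (*ₗ-distribˡ μ _ _) (≺-distribʳ _ _ _) ⟩
    (μ *ₗ (λ' *ₗ z) +ᴹ μ *ₗ (z ≺ x)) +ᴹ ((λ' *ₗ z) ≺ y +ᴹ (z ≺ x) ≺ y)
      ≈⟨ +ᴹ-cong (+ᴹ-congʳ (≈ᴹ-trans (≈ᴹ-sym (*ₗ-assoc μ λ' z)) (*ₗ-congʳ (*-comm μ λ'))))
                 (+ᴹ-cong (≺-scalarˡ λ' z y) (axiom₁ z x y)) ⟩
    ((λ' * μ) *ₗ z +ᴹ μ *ₗ (z ≺ x)) +ᴹ (λ' *ₗ (z ≺ y) +ᴹ z ≺ (x ⋆ y))
      ≈⟨ solve 4 (λ a b c d → (a ⊕ b) ⊕ (c ⊕ d) ⊜ a ⊕ ((c ⊕ b) ⊕ d)) ≈ᴹ-refl _ _ _ _ ⟩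
    (λ' * μ) *ₗ z +ᴹ ((λ' *ₗ (z ≺ y) +ᴹ μ *ₗ (z ≺ x)) +ᴹ z ≺ (x ⋆ y))
      ≈⟨ +ᴹ-congˡ (≈ᴹ-sym (≈ᴹ-trans (≺-distribˡ _ _ _)
           (+ᴹ-congʳ (≈ᴹ-trans (≺-distribˡ _ _ _) (+ᴹ-cong (≺-scalarʳ _ _ _) (≺-scalarʳ _ _ _)))))) ⟩
    (λ' * μ) *ₗ z +ᴹ z ≺ ((λ' *ₗ y +ᴹ μ *ₗ x) +ᴹ x ⋆ y) ∎

  ≻̄-assoc : ∀ z X Y → X ≻̂ ι (Y ≻̄ z) ≈ᴹ (X ⋆̄ Y) ≻̄ z
  ≻̄-assoc z (λ' , x) (μ , y) = begin
    λ' *ₗ (μ *ₗ z +ᴹ y ≻ z) +ᴹ x ≻ (μ *ₗ z +ᴹ y ≻ z)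
      ≈⟨ +ᴹ-cong (*ₗ-distribˡ λ' _ _) (≻-distribˡ _ _ _) ⟩
    (λ' *ₗ (μ *ₗ z) +ᴹ λ' *ₗ (y ≻ z)) +ᴹ (x ≻ (μ *ₗ z) +ᴹ x ≻ (y ≻ z))
      ≈⟨ +ᴹ-cong (+ᴹ-congʳ (≈ᴹ-sym (*ₗ-assoc λ' μ z)))
                 (+ᴹ-cong (≻-scalarʳ μ x z) (axiom₃ x y z)) ⟩
    ((λ' * μ) *ₗ z +ᴹ λ' *ₗ (y ≻ z)) +ᴹ (μ *ₗ (x ≻ z) +ᴹ (x ⋆ y) ≻ z)
      ≈⟨ solve 4 (λ a b c d → (a ⊕ b) ⊕ (c ⊕ d) ⊜ a ⊕ ((b ⊕ c) ⊕ d)) ≈ᴹ-refl _ _ _ _ ⟩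
    (λ' * μ) *ₗ z +ᴹ ((λ' *ₗ (y ≻ z) +ᴹ μ *ₗ (x ≻ z)) +ᴹ (x ⋆ y) ≻ z)
      ≈⟨ +ᴹ-congˡ (≈ᴹ-sym (≈ᴹ-trans (≻-distribʳ _ _ _)
           (+ᴹ-congʳ (≈ᴹ-trans (≻-distribʳ _ _ _) (+ᴹ-cong (≻-scalarˡ _ _ _) (≻-scalarˡ _ _ _)))))) ⟩
    (λ' * μ) *ₗ z +ᴹ ((λ' *ₗ y +ᴹ μ *ₗ x) +ᴹ x ⋆ y) ≻ z ∎

  proj₁-Σ̄≈0 : ∀ j (f : ℕ → Ā) → (∀ p → p < j → proj₁ (f p) ≈ 0#) → proj₁ (Σ̄ j f) ≈ 0#
  proj₁-Σ̄≈0 zero    f f≈0 = refl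
  proj₁-Σ̄≈0 (suc j) f f≈0 =
    trans (+-cong (proj₁-Σ̄≈0 j f (λ p p<j → f≈0 p (m<n⇒m<1+n p<j))) (f≈0 j (n<1+n j))) (+-identityˡ 0#)

  proj₂-Σ̄-cong : ∀ j (f g : ℕ → Ā) → (∀ p → p < j → proj₂ (f p) ≈ᴹ proj₂ (g p)) →
                 proj₂ (Σ̄ j f) ≈ᴹ proj₂ (Σ̄ j g)
  proj₂-Σ̄-cong zero    f g f≈g = ≈ᴹ-refl
  proj₂-Σ̄-cong (suc j) f g f≈g =
    +ᴹ-cong (proj₂-Σ̄-cong j f g (λ p p<j → f≈g p (m<n⇒m<1+n p<j))) (f≈g j (n<1+n j))

  proj₂-Σ̄-antidiagonal : ∀ n (h : ℕ → ℕ → Ā) →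
    proj₂ (Σ̄ (suc n) (λ p → h p (n ∸ p))) ≈ᴹ ∑-antidiagonal n (λ p q → proj₂ (h p q))
  proj₂-Σ̄-antidiagonal zero    h = +ᴹ-identityˡ _
  proj₂-Σ̄-antidiagonal (suc n) h = begin
    proj₂ (Σ̄ (suc n) (λ p → h p (suc n ∸ p))) +ᴹ proj₂ (h (suc n) (n ∸ n))
      ≈⟨ +ᴹ-cong (proj₂-Σ̄-cong (suc n) _ _ (λ p p<1+n →
                   ≈ᴹ-reflexive (cong (λ q → proj₂ (h p q)) (+-∸-assoc 1 (s≤s⁻¹ p<1+n)))))
                 (≈ᴹ-reflexive (cong (λ q → proj₂ (h (suc n) q)) (n∸n≡0 n))) ⟩
    proj₂ (Σ̄ (suc n) (λ p → h p (suc (n ∸ p)))) +ᴹ proj₂ (h (suc n) 0)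
      ≈⟨ +ᴹ-congʳ (proj₂-Σ̄-antidiagonal n (λ p q → h p (suc q))) ⟩
    ∑-antidiagonal n (λ p q → proj₂ (h p (suc q))) +ᴹ proj₂ (h (suc n) 0)
      ≈⟨ ∑-antidiagonal-unsnoc n (λ p q → proj₂ (h p q)) ⟨
    ∑-antidiagonal (suc n) (λ p q → proj₂ (h p q)) ∎

  module _ (a : Carrierᴹ) where

    w≺⋆̄w≻ : ℕ → ℕ → Ā
    w≺⋆̄w≻ p q = w≺ p a ⋆̄ w≻ q a

    convolution : (ℕ → ℕ → k) → ℕ → Carrierᴹ
    convolution c n = ∑-antidiagonal n (λ p q → c p q *ₗ proj₂ (w≺⋆̄w≻ p q))

    convolution-cong : ∀ {c d} n → (∀ p q → c p q ≈ d p q) → convolution c n ≈ᴹ convolution d n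
    convolution-cong n c≈d = ∑-antidiagonal-cong n (λ p q → *ₗ-congʳ (c≈d p q))

    convolution-+ : ∀ c d n →
      convolution (λ p q → c p q + d p q) n ≈ᴹ convolution c n +ᴹ convolution d n
    convolution-+ c d n = ≈ᴹ-trans (∑-antidiagonal-cong n (λ p q → *ₗ-distribʳ _ (c p q) (d p q)))
                                   (∑-antidiagonal-distrib n _ _)

    convolution-neg : ∀ c n → convolution (λ p q → - c p q) n ≈ᴹ -ᴹ convolution c n
    convolution-neg c n =
      ≈ᴹ-trans (∑-antidiagonal-cong n (λ p q → -‿*ₗ (c p q) _))
               (∑-antidiagonal-homo -ᴹ_ -ᴹ‿cong (λ x y → ≈ᴹ-sym (⁻¹-∙-comm x y)) n _)

    convolution-zero : ∀ c → convolution c 0 ≈ᴹ 0ᴹ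
    convolution-zero c = y≈0⇒x*y≈0 (begin
      (1# *ₗ 0ᴹ +ᴹ 1# *ₗ 0ᴹ) +ᴹ 0ᴹ ⋆ 0ᴹ  ≈⟨ +ᴹ-cong (+ᴹ-cong (*ₗ-zeroʳ 1#) (*ₗ-zeroʳ 1#)) ⋆-zero ⟩
      (0ᴹ +ᴹ 0ᴹ) +ᴹ 0ᴹ                  ≈⟨ ≈ᴹ-trans (+ᴹ-identityʳ _) (+ᴹ-identityʳ 0ᴹ) ⟩
      0ᴹ                                ∎)

    convolution-suc-peel : ∀ c n → convolution c (suc n) ≈ᴹ
      ∑-antidiagonal n (λ p q → c (suc p) q *ₗ (a ≺̄ w≺⋆̄w≻ p q) +ᴹ c p (suc q) *ₗ (w≺⋆̄w≻ p q ≻̄ a))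
    convolution-suc-peel c n = begin
      convolution c (suc n)
        ≈⟨ ∑-antidiagonal-cong (suc n) (λ p q →
             ≈ᴹ-trans (*ₗ-congˡ (⋆̄-split (w≺ p a) (w≻ q a))) (*ₗ-distribˡ (c p q) _ _)) ⟩
      ∑-antidiagonal (suc n) (λ p q → left p q +ᴹ right p q)
        ≈⟨ ∑-antidiagonal-distrib (suc n) left right ⟩
      ∑-antidiagonal (suc n) left +ᴹ ∑-antidiagonal (suc n) right
        ≈⟨ +ᴹ-cong (+ᴹ-congʳ (y≈0⇒x*y≈0 (𝟙-≺̂ (w≻ (suc n) a)))) (∑-antidiagonal-unsnoc n right) ⟩
      (0ᴹ +ᴹ ∑-antidiagonal n (λ p q → left (suc p) q)) +ᴹ
        (∑-antidiagonal n (λ p q → right p (suc q)) +ᴹ right (suc n) 0)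
        ≈⟨ +ᴹ-cong (+ᴹ-identityˡ _)
                   (≈ᴹ-trans (+ᴹ-congˡ (y≈0⇒x*y≈0 (≻̂-𝟙 (w≺ (suc n) a)))) (+ᴹ-identityʳ _)) ⟩
      ∑-antidiagonal n (λ p q → left (suc p) q) +ᴹ ∑-antidiagonal n (λ p q → right p (suc q))
        ≈⟨ +ᴹ-cong (∑-antidiagonal-cong n (λ p q → *ₗ-congˡ (≺̄-assoc a (w≺ p a) (w≻ q a))))
                   (∑-antidiagonal-cong n (λ p q → *ₗ-congˡ (≻̄-assoc a (w≺ p a) (w≻ q a)))) ⟩
      ∑-antidiagonal n (λ p q → c (suc p) q *ₗ (a ≺̄ w≺⋆̄w≻ p q)) +ᴹ
        ∑-antidiagonal n (λ p q → c p (suc q) *ₗ (w≺⋆̄w≻ p q ≻̄ a))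
        ≈⟨ ∑-antidiagonal-distrib n _ _ ⟨
      _ ∎
      where
      left right : ℕ → ℕ → Carrierᴹ
      left  p q = c p q *ₗ (w≺ p a ≺̂ w≻ q a)
      right p q = c p q *ₗ (w≺ p a ≻̂ w≻ q a)

    peel-expand : ∀ α β δ x → α *ₗ (a ≺̄ (δ , x)) +ᴹ β *ₗ ((δ , x) ≻̄ a) ≈ᴹ
                              ((β *ₗ x) ≻ a +ᴹ a ≺ (α *ₗ x)) +ᴹ ((α + β) * δ) *ₗ a
    peel-expand α β δ x = begin
      α *ₗ (δ *ₗ a +ᴹ a ≺ x) +ᴹ β *ₗ (δ *ₗ a +ᴹ x ≻ a)
        ≈⟨ +ᴹ-cong (*ₗ-distribˡ α _ _) (*ₗ-distribˡ β _ _) ⟩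
      (α *ₗ (δ *ₗ a) +ᴹ α *ₗ (a ≺ x)) +ᴹ (β *ₗ (δ *ₗ a) +ᴹ β *ₗ (x ≻ a))
        ≈⟨ +ᴹ-cong (+ᴹ-cong (*ₗ-assoc α δ a) (≺-scalarʳ α a x))
                   (+ᴹ-cong (*ₗ-assoc β δ a) (≻-scalarˡ β x a)) ⟨
      ((α * δ) *ₗ a +ᴹ a ≺ (α *ₗ x)) +ᴹ ((β * δ) *ₗ a +ᴹ (β *ₗ x) ≻ a)
        ≈⟨ solve 4 (λ u l v r → (u ⊕ l) ⊕ (v ⊕ r) ⊜ (r ⊕ l) ⊕ (u ⊕ v)) ≈ᴹ-refl _ _ _ _ ⟩
      ((β *ₗ x) ≻ a +ᴹ a ≺ (α *ₗ x)) +ᴹ ((α * δ) *ₗ a +ᴹ (β * δ) *ₗ a)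
        ≈⟨ +ᴹ-congˡ (≈ᴹ-trans (*ₗ-congʳ (distribʳ δ α β)) (*ₗ-distribʳ a (α * δ) (β * δ))) ⟨
      ((β *ₗ x) ≻ a +ᴹ a ≺ (α *ₗ x)) +ᴹ ((α + β) * δ) *ₗ a ∎

    -- collects the unit components δ·a of a ≺̄ (δ , x) and (δ , x) ≻̄ a
    unitPart : (ℕ → ℕ → k) → ℕ → Carrierᴹ
    unitPart e n = ∑-antidiagonal n (λ p q → (e p q * proj₁ (w≺⋆̄w≻ p q)) *ₗ a)

    unitPart-≈0 : ∀ e n → (∀ p q → e p q ≈ 0#) → unitPart e n ≈ᴹ 0ᴹ
    unitPart-≈0 e n e≈0 = ∑-antidiagonal-≈ε n _ (λ p q → x≈0⇒x*y≈0 (trans (*-congʳ (e≈0 p q)) (zeroˡ _)))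

    unitPart-zero : ∀ e → unitPart e 0 ≈ᴹ e 0 0 *ₗ a
    unitPart-zero e = *ₗ-congʳ (trans (*-congˡ (*-identityˡ 1#)) (*-identityʳ _))

    unitPart-suc : ∀ e n → unitPart e (suc n) ≈ᴹ 0ᴹ
    unitPart-suc e n = ≈ᴹ-trans
      (+ᴹ-cong (x≈0⇒x*y≈0 (trans (*-congˡ (zeroʳ 1#)) (zeroʳ _)))
               (∑-antidiagonal-≈ε n _ (λ p q → x≈0⇒x*y≈0 (trans (*-congˡ (zeroˡ _)) (zeroʳ _)))))
      (+ᴹ-identityˡ 0ᴹ)

    peelWeight : (ℕ → ℕ → k) → ℕ → ℕ → k
    peelWeight c p q = c (suc p) q + c p (suc q)

    convolution-suc : ∀ c n → convolution c (suc n) ≈ᴹ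
      (convolution (λ p q → c p (suc q)) n ≻ a +ᴹ a ≺ convolution (λ p q → c (suc p) q) n) +ᴹ
      unitPart (peelWeight c) n
    convolution-suc c n = begin
      convolution c (suc n)
        ≈⟨ convolution-suc-peel c n ⟩
      _ ≈⟨ ∑-antidiagonal-cong n (λ p q → peel-expand (c (suc p) q) (c p (suc q)) _ _) ⟩
      _ ≈⟨ ∑-antidiagonal-distrib n _ _ ⟩
      _ ≈⟨ +ᴹ-congʳ (∑-antidiagonal-distrib n _ _) ⟩
      _ ≈⟨ +ᴹ-congʳ (+ᴹ-cong
             (∑-antidiagonal-homo (_≻ a) (λ x≈y → ≻-cong x≈y ≈ᴹ-refl) (λ x y → ≻-distribʳ x y a) n _)
             (∑-antidiagonal-homo (a ≺_) (≺-cong ≈ᴹ-refl) (≺-distribˡ a) n _)) ⟩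
      _ ∎

    antipode⋆id : ℕ → ℕ → k
    antipode⋆id p _ = sgn p

    antipode⋆N : ℕ → ℕ → k
    antipode⋆N p q = sgn p * nat q

    antipode⋆id-vanishes : ∀ n → convolution antipode⋆id n ≈ᴹ 0ᴹ
    antipode⋆id-vanishes zero    = convolution-zero antipode⋆id
    antipode⋆id-vanishes (suc n) = begin
      convolution antipode⋆id (suc n)
        ≈⟨ convolution-suc antipode⋆id n ⟩
      (convolution antipode⋆id n ≻ a +ᴹ a ≺ convolution (λ p q → - antipode⋆id p q) n) +ᴹ
        unitPart (peelWeight antipode⋆id) n
        ≈⟨ +ᴹ-cong (+ᴹ-cong (≻-cong ih ≈ᴹ-refl) (≺-cong ≈ᴹ-refl neg-ih))
                   (unitPart-≈0 (peelWeight antipode⋆id) n (λ p _ → -‿inverseˡ (sgn p))) ⟩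
      (0ᴹ ≻ a +ᴹ a ≺ 0ᴹ) +ᴹ 0ᴹ
        ≈⟨ ≈ᴹ-trans (+ᴹ-identityʳ _) (≈ᴹ-trans (+ᴹ-cong (≻-zeroˡ a) (≺-zeroʳ a)) (+ᴹ-identityˡ 0ᴹ)) ⟩
      0ᴹ ∎
      where
      ih : convolution antipode⋆id n ≈ᴹ 0ᴹ
      ih = antipode⋆id-vanishes n
      neg-ih : convolution (λ p q → - antipode⋆id p q) n ≈ᴹ 0ᴹ
      neg-ih = ≈ᴹ-trans (convolution-neg antipode⋆id n) (≈ᴹ-trans (-ᴹ‿cong ih) ε⁻¹≈ε)

    antipode⋆N-suc : ∀ n → convolution antipode⋆N (suc n) ≈ᴹ
      convolution antipode⋆N n ▷ a +ᴹ unitPart (peelWeight antipode⋆N) n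
    antipode⋆N-suc n = begin
      convolution antipode⋆N (suc n)
        ≈⟨ convolution-suc antipode⋆N n ⟩
      _ ≈⟨ +ᴹ-congʳ (+ᴹ-cong (≻-cong shifted-right ≈ᴹ-refl)
                             (≈ᴹ-trans (≺-cong ≈ᴹ-refl shifted-left) (≺-negʳ a _))) ⟩
      _ ∎
      where
      shifted-right : convolution (λ p q → sgn p * (1# + nat q)) n ≈ᴹ convolution antipode⋆N n
      shifted-right = begin
        convolution (λ p q → sgn p * (1# + nat q)) n
          ≈⟨ convolution-cong n (λ p q → trans (distribˡ (sgn p) 1# (nat q)) (+-congʳ (*-identityʳ _))) ⟩
        convolution (λ p q → antipode⋆id p q + antipode⋆N p q) n
          ≈⟨ convolution-+ antipode⋆id antipode⋆N n ⟩
        convolution antipode⋆id n +ᴹ convolution antipode⋆N n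
          ≈⟨ +ᴹ-congʳ (antipode⋆id-vanishes n) ⟩
        0ᴹ +ᴹ convolution antipode⋆N n
          ≈⟨ +ᴹ-identityˡ _ ⟩
        convolution antipode⋆N n ∎
      shifted-left : convolution (λ p q → (- sgn p) * nat q) n ≈ᴹ -ᴹ convolution antipode⋆N n
      shifted-left = ≈ᴹ-trans (convolution-cong n (λ p q → sym (-‿distribˡ-* (sgn p) (nat q))))
                              (convolution-neg antipode⋆N n)

    antipode⋆N≈ℓ′ : ∀ n → convolution antipode⋆N (suc n) ≈ᴹ ℓ′ n a
    antipode⋆N≈ℓ′ zero = begin
      convolution antipode⋆N 1
        ≈⟨ antipode⋆N-suc 0 ⟩
      _ ≈⟨ +ᴹ-cong (≈ᴹ-trans (▷-congˡ a (convolution-zero antipode⋆N)) (▷-zeroˡ a))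
                   (≈ᴹ-trans (unitPart-zero (peelWeight antipode⋆N)) (*ₗ-congʳ coefficient≈1)) ⟩
      0ᴹ +ᴹ 1# *ₗ a
        ≈⟨ ≈ᴹ-trans (+ᴹ-identityˡ _) (*ₗ-identityˡ a) ⟩
      a ∎
      where
      coefficient≈1 : (- 1#) * 0# + 1# * (1# + 0#) ≈ 1#
      coefficient≈1 = trans (+-cong (zeroʳ _) (trans (*-identityˡ _) (+-identityʳ 1#))) (+-identityˡ 1#)
    antipode⋆N≈ℓ′ (suc n) = begin
      convolution antipode⋆N (suc (suc n))
        ≈⟨ antipode⋆N-suc (suc n) ⟩
      convolution antipode⋆N (suc n) ▷ a +ᴹ unitPart (peelWeight antipode⋆N) (suc n)
        ≈⟨ +ᴹ-cong (▷-congˡ a (antipode⋆N≈ℓ′ n)) (unitPart-suc (peelWeight antipode⋆N) n) ⟩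
      ℓ′ n a ▷ a +ᴹ 0ᴹ
        ≈⟨ +ᴹ-identityʳ _ ⟩
      ℓ′ (suc n) a ∎

    dynkinLHS-unitPart : ∀ n → proj₁ (dynkinLHS (suc n) a) ≈ 0#
    dynkinLHS-unitPart n = proj₁-Σ̄≈0 (suc n) _ (λ p p<1+n →
      trans (*-congˡ (trans (*-congˡ (reflexive (cong (λ q → proj₁ (w≻ q a)) (+-∸-assoc 1 (s≤s⁻¹ p<1+n)))))
                            (zeroʳ _)))
            (zeroʳ _))

    dynkinLHS-convolution : ∀ n → proj₂ (dynkinLHS (suc n) a) ≈ᴹ convolution antipode⋆N (suc n)
    dynkinLHS-convolution n = begin
      proj₂ (Σ̄ (suc n) term)
        ≈⟨ +ᴹ-identityʳ _ ⟨
      proj₂ (Σ̄ (suc n) term) +ᴹ 0ᴹ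
        ≈⟨ +ᴹ-congˡ (x≈0⇒x*y≈0 (trans (*-congˡ (reflexive (cong nat (n∸n≡0 n)))) (zeroʳ _))) ⟨
      proj₂ (Σ̄ (suc (suc n)) term)
        ≈⟨ proj₂-Σ̄-antidiagonal (suc n) (λ p q → antipode⋆N p q ·̄ w≺⋆̄w≻ p q) ⟩
      convolution antipode⋆N (suc n) ∎
      where
      term : ℕ → Ā
      term p = (sgn p * nat (suc n ∸ p)) ·̄ (w≺ p a ⋆̄ w≻ (suc n ∸ p) a)

lemma2p1 : {c ℓ m ℓm : Level} (K : CommutativeRing c ℓ) → IsField K →
    (M : Module K m ℓm) (D : Dendriform M) →
    let open Augmented D in
    ∀ (a : Module.Carrierᴹ M) (n : ℕ) →
    dynkinLHS (suc n) a ≈̄ ι (ℓ′ n a)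
lemma2p1 K _ M D a n =
  dynkinLHS-unitPart a n , Module.≈ᴹ-trans M (dynkinLHS-convolution a n) (antipode⋆N≈ℓ′ a n)
  where open DendriformProperties D
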